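{- Let $K$ be an algebraic extension of $\mathbb{Q}_2$ and let $U,V\in K[[t]]$ be power series of $t$-adic valuation exactly $1$ (i.e. $U=u_1t+O(t^2)$, $V=v_1t+O(t^2)$ with $u_1,v_1\neq 0$). Then the differential equation $U\cdot (z')^2 = V\circ z$ admits a unique nonzero solution $z\in tK[[t]]$.
   Context: For $z\in tK[[t]]$ the composite $V\circ z$ is a well-defined element of $K[[t]]$; $z'$ denotes the formal derivative. -}

module Defs where

open import Level using (Level; _⊔_)
open import Data.Nat as ℕ using (ℕ; zero; suc; _∸_; _^_)
open import Data.Nat.DivMod using (_/_; _%_)
open import Data.Bool using (Bool; true; false; if_then_else_)
open import Data.Product using (Σ; _×_; _,_; ∃)
open import Data.List using (List; []; _∷_; map)
open import Data.List.Relation.Unary.Any using (Any)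
open import Relation.Binary.PropositionalEquality using (_≡_)
open import Relation.Nullary using (¬_)
open import Algebra.Bundles using (CommutativeRing)

record Field (c ℓ : Level) : Set (Level.suc (c ⊔ ℓ)) where
  field
    commutativeRing : CommutativeRing c ℓ
  open CommutativeRing commutativeRing public
  field
    1≉0 : ¬ (1# ≈ 0#)
    inverse : ∀ x → ¬ (x ≈ 0#) → Σ Carrier λ y → (x * y) ≈ 1#

-- The 2-adic integers ℤ₂ as binary digit streams  x = Σ_i x(i) 2^i.
-- Digit streams represent 2-adic integers uniquely, so equality is
-- pointwise equality of digits.

ℤ₂ : Set
ℤ₂ = ℕ → Bool

_≈ℤ₂_ : ℤ₂ → ℤ₂ → Set
x ≈ℤ₂ y = ∀ n → x n ≡ y n

bit : Bool → ℕ
bit true  = 1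
bit false = 0

trunc : ℤ₂ → ℕ → ℕ
trunc x zero    = 0
trunc x (suc n) = trunc x n ℕ.+ bit (x n) ℕ.* 2 ^ n

digitℕ : ℕ → ℕ → Bool
digitℕ m zero    with m % 2
... | zero  = false
... | suc _ = true
digitℕ m (suc n) = digitℕ (m / 2) n

fromℕ₂ : ℕ → ℤ₂
fromℕ₂ m n = digitℕ m n

-- ring operations on ℤ₂: digit n of a sum/product is determined
-- by the truncations mod 2^(n+1)
_+ℤ₂_ : ℤ₂ → ℤ₂ → ℤ₂
(x +ℤ₂ y) n = digitℕ (trunc x (suc n) ℕ.+ trunc y (suc n)) n

_*ℤ₂_ : ℤ₂ → ℤ₂ → ℤ₂
(x *ℤ₂ y) n = digitℕ (trunc x (suc n) ℕ.* trunc y (suc n)) n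

-- The 2-adic numbers ℚ₂ = ℤ₂[1/2]: a pair (x , k) stands for x / 2^k.

ℚ₂ : Set
ℚ₂ = ℤ₂ × ℕ

_≈ℚ₂_ : ℚ₂ → ℚ₂ → Set
(x , k) ≈ℚ₂ (y , l) = (x *ℤ₂ fromℕ₂ (2 ^ l)) ≈ℤ₂ (y *ℤ₂ fromℕ₂ (2 ^ k))

_+ℚ₂_ : ℚ₂ → ℚ₂ → ℚ₂
(x , k) +ℚ₂ (y , l) = ((x *ℤ₂ fromℕ₂ (2 ^ l)) +ℤ₂ (y *ℤ₂ fromℕ₂ (2 ^ k))) , (k ℕ.+ l)

_*ℚ₂_ : ℚ₂ → ℚ₂ → ℚ₂
(x , k) *ℚ₂ (y , l) = (x *ℤ₂ y) , (k ℕ.+ l)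

0ℚ₂ 1ℚ₂ : ℚ₂
0ℚ₂ = fromℕ₂ 0 , 0
1ℚ₂ = fromℕ₂ 1 , 0

-- Algebraic extensions of ℚ₂: a field K together with a ring
-- homomorphism ι : ℚ₂ → K (necessarily injective) such that every
-- element of K is a root of a nonzero polynomial with ℚ₂-coefficients.

module _ {c ℓ : Level} (K : Field c ℓ) where
  open Field K

  evalPoly : List Carrier → Carrier → Carrier
  evalPoly []       a = 0#
  evalPoly (p ∷ ps) a = p + a * evalPoly ps a

  record IsRingHomFromℚ₂ (ι : ℚ₂ → Carrier) : Set (c ⊔ ℓ) where
    field
      cong-ι : ∀ {a b} → a ≈ℚ₂ b → ι a ≈ ι b
      ι-+ : ∀ a b → ι (a +ℚ₂ b) ≈ (ι a + ι b)
      ι-* : ∀ a b → ι (a *ℚ₂ b) ≈ (ι a * ι b)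
      ι-1 : ι 1ℚ₂ ≈ 1#

  record AlgebraicExtensionOfℚ₂ : Set (c ⊔ ℓ) where
    field
      ι : ℚ₂ → Carrier
      isRingHom : IsRingHomFromℚ₂ ι
      algebraic : ∀ a → Σ (List ℚ₂) λ p →
        Any (λ q → ¬ (q ≈ℚ₂ 0ℚ₂)) p × (evalPoly (map ι p) a ≈ 0#)

module PowerSeries {c ℓ : Level} (K : Field c ℓ) where
  open Field K

  PS : Set c
  PS = ℕ → Carrier

  sumBelow : ℕ → (ℕ → Carrier) → Carrier
  sumBelow zero    f = 0#
  sumBelow (suc n) f = sumBelow n f + f n

  _·_ : ℕ → Carrier → Carrier
  zero  · x = 0#
  suc n · x = x + n · x

  _⊛_ : PS → PS → PS
  (f ⊛ g) n = sumBelow (suc n) λ i → f i * g (n ∸ i)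

  one : PS
  one zero    = 1#
  one (suc n) = 0#

  _^ˢ_ : PS → ℕ → PS
  f ^ˢ zero  = one
  f ^ˢ suc k = f ⊛ (f ^ˢ k)

  deriv : PS → PS
  deriv z n = suc n · z (suc n)

  -- composition V ∘ z (for z with z 0 ≈ 0): coefficient n is
  -- Σ_{k ≤ n} V_k (z^k)_n, the terms with k > n being zero.
  _∘ˢ_ : PS → PS → PS
  (V ∘ˢ z) n = sumBelow (suc n) λ k → V k * (z ^ˢ k) n

  _≈ˢ_ : PS → PS → Set ℓ
  f ≈ˢ g = ∀ n → f n ≈ g n

  HasValuationOne : PS → Set ℓ
  HasValuationOne f = (f 0 ≈ 0#) × ¬ (f 1 ≈ 0#)

  InTK : PS → Set ℓ
  InTK z = z 0 ≈ 0#

  NonZero : PS → Set ℓ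
  NonZero z = ¬ (∀ n → z n ≈ 0#)

  IsNonzeroSolution : PS → PS → PS → Set ℓ
  IsNonzeroSolution U V z =
    InTK z × NonZero z × ((U ⊛ (deriv z ⊛ deriv z)) ≈ˢ (V ∘ˢ z))

{-# OPTIONS --safe #-}
module Submission where

-- Write z = Σ aₙ tⁿ. The coefficient of t in U (z')² = V ∘ z reads u₁ a₁² = v₁ a₁, and for n ≥ 2
-- the coefficient of tⁿ is affine in aₙ: besides terms in a₁, …, aₙ₋₁, it contains aₙ only through
-- the two cross terms u₁ (z')₀ (z')ₙ₋₁ on the left, i.e. 2n u₁ a₁ aₙ, and through v₁ aₙ on the right.
-- Hence a solution with a₁ = 0 vanishes identically; otherwise a₁ = v₁ / u₁, and then every aₙ is
-- forced by a linear equation with coefficient 2n v₁ − v₁ = (2n − 1) v₁, which is nonzero because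
-- odd integers are units of ℤ₂ ⊆ K.

open import Defs
open import Level using (Level)
open import Data.Product using (Σ; _×_; _,_)

module TwoAdic where

  open import Data.Nat using (ℕ; zero; suc; _+_; _*_; _^_; _<_; NonZero; s≤s)
  open import Data.Nat.Properties
  open import Data.Nat.DivMod
  open import Data.Nat.Divisibility using (divides)
  open import Data.Nat.Tactic.RingSolver using (solve-∀)
  open import Data.Bool using (true; false)
  open import Relation.Binary.PropositionalEquality
  open ≡-Reasoning

  2^≢0 : ∀ k → NonZero (2 ^ k)
  2^≢0 k = m^n≢0 2 k

  infixl 7 _%2^_
  _%2^_ : ℕ → ℕ → ℕ
  M %2^ k = _%_ M (2 ^ k) {{2^≢0 k}}

  bit-digitℕ-zero : ∀ M → bit (digitℕ M 0) ≡ M % 2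
  bit-digitℕ-zero M with M % 2 | m%n<n M 2
  ... | zero        | _ = refl
  ... | suc zero    | _ = refl
  ... | suc (suc _) | s≤s (s≤s ())

  bit-injective : ∀ a b → bit a ≡ bit b → a ≡ b
  bit-injective true  true  _ = refl
  bit-injective false false _ = refl

  %2^-suc-lowest : ∀ M n → M %2^ suc n ≡ M / 2 %2^ n * 2 + M % 2
  %2^-suc-lowest M n = begin
      M % 2 ^ suc n
    ≡⟨ %-congʳ (*-comm 2 (2 ^ n)) ⟩
      M % (2 ^ n * 2)
    ≡⟨ %-congˡ (trans (m≡m%n+[m/n]*n M 2) (+-comm (M % 2) _)) ⟩
      (M / 2 * 2 + M % 2) % (2 ^ n * 2)
    ≡⟨ [m*n+o]%[p*n]≡[m*n]%[p*n]+o (M / 2) (2 ^ n) (m%n<n M 2) ⟩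
      M / 2 * 2 % (2 ^ n * 2) + M % 2
    ≡⟨ cong (_+ M % 2) (m%n*o≡m*o%[n*o] (M / 2) (2 ^ n) 2) ⟨
      M / 2 % 2 ^ n * 2 + M % 2
    ∎
    where
    instance
      _ = 2^≢0 n
      _ = 2^≢0 (suc n)
      _ = m*n≢0 (2 ^ n) 2

  %2^-suc : ∀ M k → M %2^ suc k ≡ M %2^ k + bit (digitℕ M k) * 2 ^ k
  %2^-suc M zero = begin
      M % 2                          ≡⟨ bit-digitℕ-zero M ⟨
      bit (digitℕ M 0)               ≡⟨ *-identityʳ _ ⟨
      bit (digitℕ M 0) * 1           ≡⟨ cong (_+ bit (digitℕ M 0) * 1) (n%1≡0 M) ⟨
      M % 1 + bit (digitℕ M 0) * 1   ∎
  %2^-suc M (suc k) = begin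
      M %2^ suc (suc k)
    ≡⟨ %2^-suc-lowest M (suc k) ⟩
      M / 2 %2^ suc k * 2 + M % 2
    ≡⟨ cong (λ a → a * 2 + M % 2) (%2^-suc (M / 2) k) ⟩
      (M / 2 %2^ k + b * 2 ^ k) * 2 + M % 2
    ≡⟨ regroup (M / 2 %2^ k) b (2 ^ k) (M % 2) ⟩
      (M / 2 %2^ k * 2 + M % 2) + b * 2 ^ suc k
    ≡⟨ cong (_+ b * 2 ^ suc k) (%2^-suc-lowest M k) ⟨
      M %2^ suc k + b * 2 ^ suc k
    ∎
    where
    b = bit (digitℕ (M / 2) k)
    regroup : ∀ a b p r → (a + b * p) * 2 + r ≡ (a * 2 + r) + b * (2 * p)
    regroup = solve-∀

  infix 4 _∼_
  _∼_ : ℤ₂ → (ℕ → ℕ) → Set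
  x ∼ s = ∀ k → trunc x k ≡ s k %2^ k

  Compatible : (ℕ → ℕ) → Set
  Compatible s = ∀ k → s (suc k) %2^ k ≡ s k %2^ k

  limit : (ℕ → ℕ) → ℤ₂
  limit s i = digitℕ (s (suc i)) i

  limit-∼ : ∀ {s} → Compatible s → limit s ∼ s
  limit-∼ {s} compat zero = sym (n%1≡0 (s 0))
  limit-∼ {s} compat (suc k) = begin
      trunc (limit s) k + b * 2 ^ k  ≡⟨ cong (_+ b * 2 ^ k) (trans (limit-∼ compat k) (sym (compat k))) ⟩
      s (suc k) %2^ k + b * 2 ^ k    ≡⟨ %2^-suc (s (suc k)) k ⟨
      s (suc k) %2^ suc k            ∎
    where b = bit (digitℕ (s (suc k)) k)

  fromℕ₂-∼ : ∀ M → fromℕ₂ M ∼ λ _ → M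
  fromℕ₂-∼ M = limit-∼ λ _ → refl

  trunc-compatible : ∀ x → Compatible (trunc x)
  trunc-compatible x k = [m+kn]%n≡m%n (trunc x k) (bit (x k)) (2 ^ k) {{2^≢0 k}}

  module _ {_∙_ : ℕ → ℕ → ℕ}
           (%-distribˡ-∙ : ∀ m n d .{{_ : NonZero d}} → (m ∙ n) % d ≡ ((m % d) ∙ (n % d)) % d) where

    %2^-distribˡ-∙ : ∀ m n k → (m ∙ n) %2^ k ≡ ((m %2^ k) ∙ (n %2^ k)) %2^ k
    %2^-distribˡ-∙ m n k = %-distribˡ-∙ m n (2 ^ k) {{2^≢0 k}}

    compatible-∙ : ∀ {s t} → Compatible s → Compatible t → Compatible λ k → s k ∙ t k
    compatible-∙ {s} {t} cs ct k = begin
      (s (suc k) ∙ t (suc k)) %2^ k                 ≡⟨ %2^-distribˡ-∙ (s (suc k)) (t (suc k)) k ⟩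
      ((s (suc k) %2^ k) ∙ (t (suc k) %2^ k)) %2^ k ≡⟨ cong₂ (λ a b → (a ∙ b) %2^ k) (cs k) (ct k) ⟩
      ((s k %2^ k) ∙ (t k %2^ k)) %2^ k             ≡⟨ %2^-distribˡ-∙ (s k) (t k) k ⟨
      (s k ∙ t k) %2^ k                             ∎

    limit-∙-∼ : ∀ {x y s t} → x ∼ s → y ∼ t → limit (λ k → trunc x k ∙ trunc y k) ∼ λ k → s k ∙ t k
    limit-∙-∼ {x} {y} {s} {t} x∼s y∼t k = begin
      trunc (limit λ k → trunc x k ∙ trunc y k) k ≡⟨ limit-∼ (compatible-∙ (trunc-compatible x) (trunc-compatible y)) k ⟩
      (trunc x k ∙ trunc y k) %2^ k                ≡⟨ cong₂ (λ a b → (a ∙ b) %2^ k) (x∼s k) (y∼t k) ⟩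
      ((s k %2^ k) ∙ (t k %2^ k)) %2^ k            ≡⟨ %2^-distribˡ-∙ (s k) (t k) k ⟨
      (s k ∙ t k) %2^ k                            ∎

  +ℤ₂-∼ : ∀ {x y s t} → x ∼ s → y ∼ t → (x +ℤ₂ y) ∼ λ k → s k + t k
  +ℤ₂-∼ = limit-∙-∼ %-distribˡ-+

  *ℤ₂-∼ : ∀ {x y s t} → x ∼ s → y ∼ t → (x *ℤ₂ y) ∼ λ k → s k * t k
  *ℤ₂-∼ = limit-∙-∼ %-distribˡ-*

  trunc-injective : ∀ x y → (∀ n → trunc x n ≡ trunc y n) → x ≈ℤ₂ y
  trunc-injective x y eq n = bit-injective (x n) (y n)
    (*-cancelʳ-≡ (bit (x n)) (bit (y n)) (2 ^ n) {{2^≢0 n}}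
      (+-cancelˡ-≡ (trunc x n) _ _ (trans (eq (suc n)) (cong (_+ bit (y n) * 2 ^ n) (sym (eq n))))))

  ∼-≈ℤ₂ : ∀ {x y s t} → x ∼ s → y ∼ t → (∀ k → s k %2^ k ≡ t k %2^ k) → x ≈ℤ₂ y
  ∼-≈ℤ₂ {x} {y} x∼s y∼t s≡t = trunc-injective x y λ k → trans (x∼s k) (trans (s≡t k) (sym (y∼t k)))

  integral-≈ℚ₂ : ∀ {x y s t} → x ∼ s → y ∼ t → (∀ k → s k %2^ k ≡ t k %2^ k) → (x , 0) ≈ℚ₂ (y , 0)
  integral-≈ℚ₂ {s = s} {t} x∼s y∼t s≡t =
    ∼-≈ℤ₂ (*ℤ₂-∼ x∼s (fromℕ₂-∼ 1)) (*ℤ₂-∼ y∼t (fromℕ₂-∼ 1)) λ k →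
      trans (cong (_%2^ k) (*-identityʳ (s k))) (trans (s≡t k) (cong (_%2^ k) (sym (*-identityʳ (t k)))))

  fromℕ₂-homo-+ : ∀ m n → (fromℕ₂ (m + n) , 0) ≈ℚ₂ ((fromℕ₂ m , 0) +ℚ₂ (fromℕ₂ n , 0))
  fromℕ₂-homo-+ m n =
    integral-≈ℚ₂ (fromℕ₂-∼ (m + n)) (+ℤ₂-∼ (*ℤ₂-∼ (fromℕ₂-∼ m) (fromℕ₂-∼ 1)) (*ℤ₂-∼ (fromℕ₂-∼ n) (fromℕ₂-∼ 1)))
      λ k → cong (_%2^ k) (sym (cong₂ _+_ (*-identityʳ m) (*-identityʳ n)))

  1<2^suc : ∀ k → 1 < 2 ^ suc k
  1<2^suc k = *-monoʳ-≤ 2 (m^n>0 2 k)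

  ^-double : ∀ N p → N ^ (2 * p) ≡ N ^ p * N ^ p
  ^-double N p = trans (^-distribˡ-+-* N p (p + 0)) (cong (λ e → N ^ p * N ^ e) (+-identityʳ p))

  square-%2^-≡1 : ∀ A k → A %2^ suc k ≡ 1 → A * A %2^ suc (suc k) ≡ 1
  square-%2^-≡1 A k A≡1 = begin
      A * A %2^ suc (suc k)
    ≡⟨ cong (λ a → a * a %2^ suc (suc k)) A≡1+q2^ ⟩
      (1 + q * 2 ^ suc k) * (1 + q * 2 ^ suc k) %2^ suc (suc k)
    ≡⟨ cong (_%2^ suc (suc k)) (expand q (2 ^ k)) ⟩
      (1 + (q + q * q * 2 ^ k) * 2 ^ suc (suc k)) %2^ suc (suc k)
    ≡⟨ [m+kn]%n≡m%n 1 (q + q * q * 2 ^ k) (2 ^ suc (suc k)) ⟩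
      1 %2^ suc (suc k)
    ≡⟨ m<n⇒m%n≡m (1<2^suc (suc k)) ⟩
      1
    ∎
    where
    instance
      _ = 2^≢0 (suc k)
      _ = 2^≢0 (suc (suc k))
    q = A / 2 ^ suc k
    A≡1+q2^ : A ≡ 1 + q * 2 ^ suc k
    A≡1+q2^ = trans (m≡m%n+[m/n]*n A (2 ^ suc k)) (cong (_+ q * 2 ^ suc k) A≡1)
    expand : ∀ q p → (1 + q * (2 * p)) * (1 + q * (2 * p)) ≡ 1 + (q + q * q * p) * (2 * (2 * p))
    expand = solve-∀

  module _ (m : ℕ) where

    private
      N : ℕ
      N = suc (m + m)

    odd-^2^ : ∀ k → N ^ 2 ^ k %2^ suc k ≡ 1
    odd-^2^ zero = trans (cong (_% 2) (odd≡1+m*2 m)) ([m+kn]%n≡m%n 1 m 2)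
      where
      odd≡1+m*2 : ∀ m → suc (m + m) * 1 ≡ 1 + m * 2
      odd≡1+m*2 = solve-∀
    odd-^2^ (suc k) = trans (cong (_%2^ suc (suc k)) (^-double N (2 ^ k))) (square-%2^-≡1 _ k (odd-^2^ k))

    odd-^2^-%2^ : ∀ k → N ^ 2 ^ k %2^ k ≡ 1 %2^ k
    odd-^2^-%2^ k = trans (sym (m∣n⇒o%n%m≡o%m (2 ^ k) (2 ^ suc k) _ (divides 2 refl))) (cong (_%2^ k) (odd-^2^ k))
      where
      instance
        _ = 2^≢0 k
        _ = 2^≢0 (suc k)

    -- N · N^(2^k − 1) ≡ 1 (mod 2^k): a compatible sequence of inverses modulo 2^k.
    inverse-mod2^ : ℕ → ℕ
    inverse-mod2^ zero    = 1
    inverse-mod2^ (suc k) = inverse-mod2^ k * N ^ 2 ^ k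

    *-inverse-mod2^ : ∀ k → N * inverse-mod2^ k ≡ N ^ 2 ^ k
    *-inverse-mod2^ zero    = refl
    *-inverse-mod2^ (suc k) = begin
      N * (inverse-mod2^ k * N ^ 2 ^ k)  ≡⟨ *-assoc N (inverse-mod2^ k) (N ^ 2 ^ k) ⟨
      N * inverse-mod2^ k * N ^ 2 ^ k    ≡⟨ cong (_* N ^ 2 ^ k) (*-inverse-mod2^ k) ⟩
      N ^ 2 ^ k * N ^ 2 ^ k              ≡⟨ ^-double N (2 ^ k) ⟨
      N ^ 2 ^ suc k                      ∎

    inverse-mod2^-compatible : Compatible inverse-mod2^
    inverse-mod2^-compatible k = begin
      t * N ^ 2 ^ k %2^ k                 ≡⟨ %-distribˡ-* t (N ^ 2 ^ k) (2 ^ k) ⟩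
      (t %2^ k) * (N ^ 2 ^ k %2^ k) %2^ k ≡⟨ cong (λ a → (t %2^ k) * a %2^ k) (odd-^2^-%2^ k) ⟩
      (t %2^ k) * (1 %2^ k) %2^ k         ≡⟨ %-distribˡ-* t 1 (2 ^ k) ⟨
      t * 1 %2^ k                         ≡⟨ cong (_%2^ k) (*-identityʳ t) ⟩
      t %2^ k                             ∎
      where
      instance _ = 2^≢0 k
      t = inverse-mod2^ k

    odd-invertible : Σ ℚ₂ λ y → ((fromℕ₂ (suc (m + m)) , 0) *ℚ₂ y) ≈ℚ₂ 1ℚ₂
    odd-invertible = (limit inverse-mod2^ , 0) ,
      integral-≈ℚ₂ (*ℤ₂-∼ (fromℕ₂-∼ N) (limit-∼ inverse-mod2^-compatible)) (fromℕ₂-∼ 1)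
        λ k → trans (cong (_%2^ k) (*-inverse-mod2^ k)) (odd-^2^-%2^ k)

-- Only the embedding ι : ℚ₂ → K enters the proof.
module CharacteristicZero {c ℓ : Level} (K : Field c ℓ) (E : AlgebraicExtensionOfℚ₂ K) where

  open import Data.Nat as ℕ using (zero; suc)
  open import Data.Product using (proj₁; proj₂)
  open import Relation.Nullary using (¬_)
  open Field K
  open PowerSeries K using (_·_)
  open AlgebraicExtensionOfℚ₂ E using (ι; isRingHom)
  open IsRingHomFromℚ₂ isRingHom
  open import Relation.Binary.Reasoning.Setoid setoid

  ι-fromℕ₂ : ∀ n → ι (fromℕ₂ (suc n) , 0) ≈ suc n · 1#
  ι-fromℕ₂ zero    = trans ι-1 (sym (+-identityʳ 1#))
  ι-fromℕ₂ (suc n) = begin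
    ι (fromℕ₂ (suc (suc n)) , 0)        ≈⟨ cong-ι (TwoAdic.fromℕ₂-homo-+ 1 (suc n)) ⟩
    ι (1ℚ₂ +ℚ₂ (fromℕ₂ (suc n) , 0))    ≈⟨ ι-+ 1ℚ₂ _ ⟩
    ι 1ℚ₂ + ι (fromℕ₂ (suc n) , 0)      ≈⟨ +-cong ι-1 (ι-fromℕ₂ n) ⟩
    1# + suc n · 1#                     ∎

  odd·1≉0 : ∀ m → ¬ (suc (m ℕ.+ m) · 1# ≈ 0#)
  odd·1≉0 m odd≈0 = 1≉0 (begin
    1#                        ≈⟨ ι-1 ⟨
    ι 1ℚ₂                     ≈⟨ cong-ι (proj₂ (TwoAdic.odd-invertible m)) ⟨
    ι ((fromℕ₂ N , 0) *ℚ₂ y)  ≈⟨ ι-* _ y ⟩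
    ι (fromℕ₂ N , 0) * ι y    ≈⟨ *-congʳ (trans (ι-fromℕ₂ (m ℕ.+ m)) odd≈0) ⟩
    0# * ι y                  ≈⟨ zeroˡ (ι y) ⟩
    0#                        ∎)
    where
    N = suc (m ℕ.+ m)
    y = proj₁ (TwoAdic.odd-invertible m)

module FieldProperties {c ℓ : Level} (K : Field c ℓ) where

  open import Data.Nat as ℕ using (zero; suc)
  open import Data.Product using (proj₁; proj₂)
  open import Relation.Nullary using (¬_)
  open Field K
  open PowerSeries K using (_·_)
  open import Algebra.Properties.Ring ring using (//-rightDividesˡ)
  open import Algebra.Properties.Monoid.Mult +-monoid using (×-congʳ; ×-homo-+) renaming (_×_ to _×ᴹ_)
  open import Algebra.Properties.Semiring.Mult semiring using (×-comm-*; ×-assoc-*)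
  open import Algebra.Properties.CommutativeMonoid.Mult +-commutativeMonoid using (×-distrib-+)
  open import Relation.Binary.Reasoning.Setoid setoid

  _⁻¹⟨_⟩ : (x : Carrier) → ¬ x ≈ 0# → Carrier
  x ⁻¹⟨ x≉0 ⟩ = proj₁ (inverse x x≉0)

  x*[y*x⁻¹]≈y : ∀ x y (x≉0 : ¬ x ≈ 0#) → x * (y * x ⁻¹⟨ x≉0 ⟩) ≈ y
  x*[y*x⁻¹]≈y x y x≉0 = begin
    x * (y * x ⁻¹⟨ x≉0 ⟩)  ≈⟨ *-congˡ (*-comm y _) ⟩
    x * (x ⁻¹⟨ x≉0 ⟩ * y)  ≈⟨ *-assoc x _ y ⟨
    x * x ⁻¹⟨ x≉0 ⟩ * y    ≈⟨ *-congʳ (proj₂ (inverse x x≉0)) ⟩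
    1# * y                 ≈⟨ *-identityˡ y ⟩
    y                      ∎

  *-cancelˡ : ∀ {x y z} → ¬ x ≈ 0# → x * y ≈ x * z → y ≈ z
  *-cancelˡ {x} {y} {z} x≉0 xy≈xz = begin
    y                           ≈⟨ x*[y*x⁻¹]≈y x y x≉0 ⟨
    x * (y * x ⁻¹⟨ x≉0 ⟩)       ≈⟨ *-assoc x y _ ⟨
    x * y * x ⁻¹⟨ x≉0 ⟩         ≈⟨ *-congʳ xy≈xz ⟩
    x * z * x ⁻¹⟨ x≉0 ⟩         ≈⟨ *-assoc x z _ ⟩
    x * (z * x ⁻¹⟨ x≉0 ⟩)       ≈⟨ x*[y*x⁻¹]≈y x z x≉0 ⟩
    z                           ∎

  *-cancelʳ : ∀ {x y z} → ¬ x ≈ 0# → y * x ≈ z * x → y ≈ z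
  *-cancelʳ {x} {y} {z} x≉0 yx≈zx = *-cancelˡ x≉0 (trans (*-comm x y) (trans yx≈zx (*-comm z x)))

  x*y≈0⇒y≈0 : ∀ {x y} → ¬ x ≈ 0# → x * y ≈ 0# → y ≈ 0#
  x*y≈0⇒y≈0 {x} x≉0 xy≈0 = *-cancelˡ x≉0 (trans xy≈0 (sym (zeroʳ x)))

  *-≉0 : ∀ {x y} → ¬ x ≈ 0# → ¬ y ≈ 0# → ¬ x * y ≈ 0#
  *-≉0 x≉0 y≉0 xy≈0 = y≉0 (x*y≈0⇒y≈0 x≉0 xy≈0)

  x≈y+[x-y] : ∀ x y → x ≈ y + (x - y)
  x≈y+[x-y] x y = sym (trans (+-comm y (x - y)) (//-rightDividesˡ y x))

  -- _·_ of Defs is the standard library's _×_ on the additive monoid; its laws are transported from there.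
  ·≈× : ∀ n x → n · x ≈ n ×ᴹ x
  ·≈× zero    x = refl
  ·≈× (suc n) x = +-congˡ (·≈× n x)

  ·-congʳ : ∀ n {x y} → x ≈ y → n · x ≈ n · y
  ·-congʳ n {x} {y} x≈y = trans (·≈× n x) (trans (×-congʳ n x≈y) (sym (·≈× n y)))

  ·-homo-1 : ∀ x → 1 · x ≈ x
  ·-homo-1 = +-identityʳ

  ·-homo-+ : ∀ x m n → (m ℕ.+ n) · x ≈ m · x + n · x
  ·-homo-+ x m n = trans (·≈× (m ℕ.+ n) x) (trans (×-homo-+ x m n) (sym (+-cong (·≈× m x) (·≈× n x))))

  ·-distrib-+ : ∀ n x y → n · (x + y) ≈ n · x + n · y
  ·-distrib-+ n x y = trans (·≈× n (x + y)) (trans (×-distrib-+ x y n) (sym (+-cong (·≈× n x) (·≈× n y))))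

  ·-assoc-* : ∀ n x y → (n · x) * y ≈ n · (x * y)
  ·-assoc-* n x y = trans (*-congʳ (·≈× n x)) (trans (×-assoc-* n x y) (sym (·≈× n (x * y))))

  ·-comm-* : ∀ n x y → x * (n · y) ≈ n · (x * y)
  ·-comm-* n x y = trans (*-congˡ (·≈× n y)) (trans (×-comm-* n x y) (sym (·≈× n (x * y))))

  ·-zeroʳ : ∀ n → n · 0# ≈ 0#
  ·-zeroʳ n = begin
    n · 0#          ≈⟨ ·-congʳ n (zeroˡ 0#) ⟨
    n · (0# * 0#)   ≈⟨ ·-assoc-* n 0# 0# ⟨
    (n · 0#) * 0#   ≈⟨ zeroʳ _ ⟩
    0#              ∎

  ·≈·1* : ∀ n x → n · x ≈ (n · 1#) * x
  ·≈·1* n x = sym (trans (·-assoc-* n 1# x) (·-congʳ n (*-identityˡ x)))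

module PowerSeriesProperties {c ℓ : Level} (K : Field c ℓ) where

  open import Data.Nat as ℕ using (ℕ; zero; suc; _∸_; _<_; s≤s; z≤n)
  open import Data.Nat.Properties
    using (≤-refl; ≤-pred; ≤-<-trans; m<n⇒m<1+n; m<1+n⇒m<n∨m≡n; <⇒≢; m∸n≤m; n∸n≡0; m<n⇒0<n∸m; ∸-monoʳ-<)
  open import Data.Empty using (⊥-elim)
  open import Data.Sum using (inj₁; inj₂)
  open import Relation.Binary.PropositionalEquality as ≡ using (_≢_)
  open Field K
  open PowerSeries K
  open FieldProperties K
  open import Algebra.Properties.CommutativeSemigroup +-commutativeSemigroup using (interchange; xy∙z≈xz∙y)
  open import Relation.Binary.Reasoning.Setoid setoid

  sumBelow-cong : ∀ n {f g} → (∀ i → i < n → f i ≈ g i) → sumBelow n f ≈ sumBelow n g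
  sumBelow-cong zero    f≈g = refl
  sumBelow-cong (suc n) f≈g = +-cong (sumBelow-cong n λ i i<n → f≈g i (m<n⇒m<1+n i<n)) (f≈g n ≤-refl)

  sumBelow-zero : ∀ n {f} → (∀ i → i < n → f i ≈ 0#) → sumBelow n f ≈ 0#
  sumBelow-zero zero    f≈0 = refl
  sumBelow-zero (suc n) f≈0 =
    trans (+-cong (sumBelow-zero n λ i i<n → f≈0 i (m<n⇒m<1+n i<n)) (f≈0 n ≤-refl)) (+-identityʳ 0#)

  sumBelow-perturb : ∀ n {p f g x} → p < n → f p ≈ g p + x → (∀ i → i < n → i ≢ p → f i ≈ g i) →
    sumBelow n f ≈ sumBelow n g + x
  sumBelow-perturb (suc n) {p} {f} {g} {x} p<1+n fp≈gp+x f≈g with m<1+n⇒m<n∨m≡n p<1+n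
  ... | inj₁ p<n = begin
    sumBelow n f + f n      ≈⟨ +-cong (sumBelow-perturb n p<n fp≈gp+x λ i i<n → f≈g i (m<n⇒m<1+n i<n))
                                      (f≈g n ≤-refl λ n≡p → <⇒≢ p<n (≡.sym n≡p)) ⟩
    sumBelow n g + x + g n  ≈⟨ xy∙z≈xz∙y _ x (g n) ⟩
    sumBelow n g + g n + x  ∎
  ... | inj₂ ≡.refl = begin
    sumBelow n f + f n      ≈⟨ +-cong (sumBelow-cong n λ i i<n → f≈g i (m<n⇒m<1+n i<n) (<⇒≢ i<n)) fp≈gp+x ⟩
    sumBelow n g + (g n + x) ≈⟨ +-assoc _ (g n) x ⟨
    sumBelow n g + g n + x  ∎

  AgreeBelow : ℕ → PS → PS → Set ℓ
  AgreeBelow n f g = ∀ i → i < n → f i ≈ g i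

  agreeBelow-suc : ∀ {n f g} → AgreeBelow n f g → f n ≈ g n → AgreeBelow (suc n) f g
  agreeBelow-suc f≈g fn≈gn i i<1+n with m<1+n⇒m<n∨m≡n i<1+n
  ... | inj₁ i<n    = f≈g i i<n
  ... | inj₂ ≡.refl = fn≈gn

  deriv-agree : ∀ {n z w} → AgreeBelow (suc n) z w → AgreeBelow n (deriv z) (deriv w)
  deriv-agree z≈w i i<n = ·-congʳ (suc i) (z≈w (suc i) (s≤s i<n))

  ⊛-agree : ∀ {n f f' g g'} → AgreeBelow n f f' → AgreeBelow n g g' → AgreeBelow n (f ⊛ g) (f' ⊛ g')
  ⊛-agree f≈f' g≈g' m m<n = sumBelow-cong (suc m) λ i i<1+m →
    *-cong (f≈f' i (≤-<-trans (≤-pred i<1+m) m<n)) (g≈g' (m ∸ i) (≤-<-trans (m∸n≤m m i) m<n))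

  ^ˢ-agree : ∀ {n z w} → AgreeBelow n z w → ∀ j → AgreeBelow n (z ^ˢ j) (w ^ˢ j)
  ^ˢ-agree z≈w zero    _ _ = refl
  ^ˢ-agree z≈w (suc j)     = ⊛-agree z≈w (^ˢ-agree z≈w j)

  deriv-perturb : ∀ {m z w δ} → z (suc m) ≈ w (suc m) + δ → deriv z m ≈ deriv w m + suc m · δ
  deriv-perturb {m} z-top = trans (·-congʳ (suc m) z-top) (·-distrib-+ (suc m) _ _)

  ⊛-perturb : ∀ k {f f' g g' α β} → AgreeBelow (suc k) f f' → AgreeBelow (suc k) g g' →
    f (suc k) ≈ f' (suc k) + α → g (suc k) ≈ g' (suc k) + β →
    (f ⊛ g) (suc k) ≈ (f' ⊛ g') (suc k) + (f' 0 * β + α * g' 0)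
  ⊛-perturb k {f} {f'} {g} {g'} {α} {β} f≈f' g≈g' f-top g-top = begin
    sumBelow (suc k) h + h (suc k)                                ≈⟨ +-cong bottom top ⟩
    (sumBelow (suc k) h' + f' 0 * β) + (h' (suc k) + α * g' k∸k)  ≈⟨ interchange _ _ _ _ ⟩
    (sumBelow (suc k) h' + h' (suc k)) + (f' 0 * β + α * g' k∸k)  ≈⟨ +-congˡ (+-congˡ (*-congˡ g'k∸k≈g'0)) ⟩
    (sumBelow (suc k) h' + h' (suc k)) + (f' 0 * β + α * g' 0)    ∎
    where
    k∸k = k ∸ k
    h h' : ℕ → Carrier
    h  i = f i * g (suc k ∸ i)
    h' i = f' i * g' (suc k ∸ i)
    g'k∸k≈g'0 : g' k∸k ≈ g' 0
    g'k∸k≈g'0 = reflexive (≡.cong g' (n∸n≡0 k))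
    top : h (suc k) ≈ h' (suc k) + α * g' k∸k
    top = trans (*-cong f-top (g≈g' k∸k (s≤s (m∸n≤m k k)))) (distribʳ _ _ _)
    middle : ∀ i → i < suc k → i ≢ 0 → h i ≈ h' i
    middle zero    _     0≢0 = ⊥-elim (0≢0 ≡.refl)
    middle (suc i) i<1+k _   = *-cong (f≈f' (suc i) i<1+k) (g≈g' (k ∸ i) (s≤s (m∸n≤m k i)))
    bottom : sumBelow (suc k) h ≈ sumBelow (suc k) h' + f' 0 * β
    bottom = sumBelow-perturb (suc k) (s≤s z≤n) (trans (*-cong (f≈f' 0 (s≤s z≤n)) g-top) (distribˡ _ _ _)) middle

  ⊛-perturbʳ : ∀ m {f g g' β} → InTK f → AgreeBelow m g g' → g m ≈ g' m + β →
    (f ⊛ g) (suc m) ≈ (f ⊛ g') (suc m) + f 1 * β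
  ⊛-perturbʳ m {f} {g} {g'} f0≈0 g≈g' g-top =
    sumBelow-perturb (suc (suc m)) (s≤s (s≤s z≤n)) (trans (*-congˡ g-top) (distribˡ _ _ _)) others
    where
    f0*≈0 : ∀ x → f 0 * x ≈ 0#
    f0*≈0 x = trans (*-congʳ f0≈0) (zeroˡ x)
    others : ∀ i → i < suc (suc m) → i ≢ 1 → f i * g (suc m ∸ i) ≈ f i * g' (suc m ∸ i)
    others zero          _                _   = trans (f0*≈0 _) (sym (f0*≈0 _))
    others (suc zero)    _                1≢1 = ⊥-elim (1≢1 ≡.refl)
    others (suc (suc i)) (s≤s (s≤s i<m)) _   = *-congˡ (g≈g' (m ∸ suc i) (∸-monoʳ-< (s≤s z≤n) i<m))

  ^ˢ-suc-InTK : ∀ {z} j → InTK z → InTK (z ^ˢ suc j)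
  ^ˢ-suc-InTK j z0≈0 = trans (+-identityˡ _) (trans (*-congʳ z0≈0) (zeroˡ _))

  ^ˢ-one : ∀ z n → (z ^ˢ 1) n ≈ z n
  ^ˢ-one z n = begin
    sumBelow n (λ i → z i * one (n ∸ i)) + z n * one (n ∸ n)
      ≈⟨ +-cong (sumBelow-zero n below) (*-congˡ (reflexive (≡.cong one (n∸n≡0 n)))) ⟩
    0# + z n * 1#  ≈⟨ +-identityˡ _ ⟩
    z n * 1#       ≈⟨ *-identityʳ (z n) ⟩
    z n            ∎
    where
    one-pos : ∀ {r} → 0 < r → one r ≈ 0#
    one-pos {suc r} _ = refl
    below : ∀ i → i < n → z i * one (n ∸ i) ≈ 0#
    below i i<n = trans (*-congˡ (one-pos (m<n⇒0<n∸m i<n))) (zeroʳ (z i))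

  -- The perturbations that ⊛-perturb produces are multiplied by z 0 = 0 and (z ^ˢ suc j) 0 = 0.
  ^ˢ-top : ∀ k j {z w} → InTK z → AgreeBelow (suc k) z w →
    (z ^ˢ suc (suc j)) (suc k) ≈ (w ^ˢ suc (suc j)) (suc k)
  ^ˢ-top k j {z} {w} z0≈0 z≈w = begin
    (z ⊛ (z ^ˢ suc j)) (suc k)
      ≈⟨ ⊛-perturb k z≈w (^ˢ-agree z≈w (suc j)) (x≈y+[x-y] _ _) (x≈y+[x-y] _ _) ⟩
    (w ⊛ (w ^ˢ suc j)) (suc k) + (w 0 * _ + _ * (w ^ˢ suc j) 0)
      ≈⟨ +-congˡ (+-cong (trans (*-congʳ w0≈0) (zeroˡ _)) (trans (*-congˡ (^ˢ-suc-InTK j w0≈0)) (zeroʳ _))) ⟩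
    (w ⊛ (w ^ˢ suc j)) (suc k) + (0# + 0#)
      ≈⟨ trans (+-congˡ (+-identityʳ 0#)) (+-identityʳ _) ⟩
    (w ⊛ (w ^ˢ suc j)) (suc k)
      ∎
    where
    w0≈0 : InTK w
    w0≈0 = trans (sym (z≈w 0 (s≤s z≤n))) z0≈0

  ∘ˢ-perturb : ∀ m {V z w δ} → InTK z → AgreeBelow (suc m) z w → z (suc m) ≈ w (suc m) + δ →
    (V ∘ˢ z) (suc m) ≈ (V ∘ˢ w) (suc m) + V 1 * δ
  ∘ˢ-perturb m {V} {z} {w} {δ} z0≈0 z≈w z-top =
    sumBelow-perturb (suc (suc m)) (s≤s (s≤s z≤n)) linear others
    where
    linear : V 1 * (z ^ˢ 1) (suc m) ≈ V 1 * (w ^ˢ 1) (suc m) + V 1 * δ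
    linear = trans (*-congˡ (trans (^ˢ-one z _) (trans z-top (+-congʳ (sym (^ˢ-one w _)))))) (distribˡ _ _ _)
    others : ∀ j → j < suc (suc m) → j ≢ 1 → V j * (z ^ˢ j) (suc m) ≈ V j * (w ^ˢ j) (suc m)
    others zero          _ _   = refl
    others (suc zero)    _ 1≢1 = ⊥-elim (1≢1 ≡.refl)
    others (suc (suc j)) _ _   = *-congˡ (^ˢ-top m j z0≈0 z≈w)

  ⊛-InTK-0 : ∀ {f} g → InTK f → (f ⊛ g) 0 ≈ 0#
  ⊛-InTK-0 g f0≈0 = trans (+-identityˡ _) (trans (*-congʳ f0≈0) (zeroˡ (g 0)))

  ⊛-InTK-1 : ∀ {f} g → InTK f → (f ⊛ g) 1 ≈ f 1 * g 0
  ⊛-InTK-1 {f} g f0≈0 = trans (+-congʳ (⊛-InTK-0 {f} (λ i → g (suc i)) f0≈0)) (+-identityˡ _)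

  ∘ˢ-0 : ∀ V z → (V ∘ˢ z) 0 ≈ V 0
  ∘ˢ-0 V z = trans (+-identityˡ _) (*-identityʳ (V 0))

  ∘ˢ-1 : ∀ V z → (V ∘ˢ z) 1 ≈ V 1 * z 1
  ∘ˢ-1 V z = trans (+-cong (trans (+-identityˡ _) (zeroʳ (V 0))) (*-congˡ (^ˢ-one z 1))) (+-identityˡ _)

  0ˢ : PS
  0ˢ _ = 0#

  ⊛-zeroˡ : ∀ {f} g n → (∀ i → f i ≈ 0#) → (f ⊛ g) n ≈ 0#
  ⊛-zeroˡ g n f≈0 = sumBelow-zero (suc n) λ i _ → trans (*-congʳ (f≈0 i)) (zeroˡ _)

  ⊛-zeroʳ : ∀ f {g} n → (∀ i → g i ≈ 0#) → (f ⊛ g) n ≈ 0#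
  ⊛-zeroʳ f {g} n g≈0 = sumBelow-zero (suc n) λ i _ → trans (*-congˡ (g≈0 (n ∸ i))) (zeroʳ (f i))

module Equation {c ℓ : Level} (K : Field c ℓ) (U V : PowerSeries.PS K) where

  open import Data.Nat as ℕ using (ℕ; zero; suc; _<_)
  open import Data.Nat.Properties using (+-suc)
  open import Relation.Nullary using (¬_)
  import Relation.Binary.PropositionalEquality as ≡
  open Field K
  open PowerSeries K
  open FieldProperties K
  open PowerSeriesProperties K
  open import Algebra.Properties.Ring ring
    using (x∙y⁻¹≈ε⇒x≈y; x≈y⇒x∙y⁻¹≈ε; [y-z]x≈yx-zx; +-identityʳ-unique; -‿+-comm)
  open import Algebra.Properties.CommutativeSemigroup +-commutativeSemigroup using (interchange)
  open import Relation.Binary.Reasoning.Setoid setoid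

  residual : PS → ℕ → Carrier
  residual z n = (U ⊛ (deriv z ⊛ deriv z)) n - (V ∘ˢ z) n

  residual≈0 : ∀ {z} → (U ⊛ (deriv z ⊛ deriv z)) ≈ˢ (V ∘ˢ z) → ∀ n → residual z n ≈ 0#
  residual≈0 solves n = x≈y⇒x∙y⁻¹≈ε (solves n)

  residual≈0⇒solves : ∀ {z} → (∀ n → residual z n ≈ 0#) → (U ⊛ (deriv z ⊛ deriv z)) ≈ˢ (V ∘ˢ z)
  residual≈0⇒solves residual≈0 n = x∙y⁻¹≈ε⇒x≈y _ _ (residual≈0 n)

  residual-0 : InTK U → InTK V → ∀ z → residual z 0 ≈ 0#
  residual-0 U0≈0 V0≈0 z = x≈y⇒x∙y⁻¹≈ε (trans (⊛-InTK-0 {U} (deriv z ⊛ deriv z) U0≈0) (sym (trans (∘ˢ-0 V z) V0≈0)))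

  residual-1 : InTK U → ∀ z → residual z 1 ≈ U 1 * z 1 * z 1 - V 1 * z 1
  residual-1 U0≈0 z = +-cong (trans (⊛-InTK-1 {U} (deriv z ⊛ deriv z) U0≈0) (trans (*-congˡ z'0²) (sym (*-assoc _ _ _)))) (-‿cong (∘ˢ-1 V z))
    where
    z'0² : (deriv z ⊛ deriv z) 0 ≈ z 1 * z 1
    z'0² = trans (+-identityˡ _) (*-cong (·-homo-1 (z 1)) (·-homo-1 (z 1)))

  residual-0ˢ : InTK V → ∀ n → residual 0ˢ n ≈ 0#
  residual-0ˢ V0≈0 n = x≈y⇒x∙y⁻¹≈ε (trans lhs≈0 (sym (rhs≈0 n)))
    where
    lhs≈0 : (U ⊛ (deriv 0ˢ ⊛ deriv 0ˢ)) n ≈ 0#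
    lhs≈0 = ⊛-zeroʳ U n λ m → ⊛-zeroˡ (deriv 0ˢ) m λ i → ·-zeroʳ (suc i)
    rhs≈0 : ∀ n → (V ∘ˢ 0ˢ) n ≈ 0#
    rhs≈0 zero    = trans (∘ˢ-0 V 0ˢ) V0≈0
    rhs≈0 (suc m) = sumBelow-zero (suc (suc m)) term
      where
      term : ∀ j → j < suc (suc m) → V j * (0ˢ ^ˢ j) (suc m) ≈ 0#
      term zero    _ = zeroʳ (V 0)
      term (suc j) _ = trans (*-congˡ (⊛-zeroˡ (0ˢ ^ˢ j) (suc m) λ _ → refl)) (zeroʳ (V (suc j)))

  slope : ℕ → Carrier → Carrier
  slope n c = (n ℕ.+ n) · c - V 1

  slope-cong : ∀ n {c c'} → c ≈ c' → slope n c ≈ slope n c'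
  slope-cong n c≈c' = +-congʳ (·-congʳ (n ℕ.+ n) c≈c')

  slope≈0⇒ : ∀ n c → slope n c ≈ 0# → (n ℕ.+ n) · c ≈ V 1
  slope≈0⇒ n c = x∙y⁻¹≈ε⇒x≈y ((n ℕ.+ n) · c) (V 1)

  slope-0≉0 : ∀ n {c} → ¬ V 1 ≈ 0# → c ≈ 0# → ¬ slope n c ≈ 0#
  slope-0≉0 n {c} V1≉0 c≈0 s≈0 = V1≉0 (trans (sym (slope≈0⇒ n c s≈0)) (trans (·-congʳ (n ℕ.+ n) c≈0) (·-zeroʳ (n ℕ.+ n))))

  slope-V1≉0 : (∀ m → ¬ suc (m ℕ.+ m) · 1# ≈ 0#) → ¬ V 1 ≈ 0# → ∀ m → ¬ slope (suc m) (V 1) ≈ 0#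
  slope-V1≉0 odd·1≉0 V1≉0 m s≈0 = *-≉0 (odd·1≉0 m) V1≉0 (begin
    suc (m ℕ.+ m) · 1# * V 1  ≈⟨ ·≈·1* (suc (m ℕ.+ m)) (V 1) ⟨
    suc (m ℕ.+ m) · V 1       ≈⟨ reflexive (≡.cong (_· V 1) (+-suc m m)) ⟨
    (m ℕ.+ suc m) · V 1       ≈⟨ +-identityʳ-unique (V 1) _ (slope≈0⇒ (suc m) (V 1) s≈0) ⟩
    0#                        ∎)

  cross-terms : ∀ n u a δ → u * ((1 · a) * (n · δ) + (n · δ) * (1 · a)) ≈ (n ℕ.+ n) · (u * a) * δ
  cross-terms n u a δ = begin
    u * ((1 · a) * (n · δ) + (n · δ) * (1 · a))  ≈⟨ *-congˡ (+-cong left right) ⟩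
    u * (n · (a * δ) + n · (a * δ))              ≈⟨ *-congˡ (·-homo-+ (a * δ) n n) ⟨
    u * ((n ℕ.+ n) · (a * δ))                    ≈⟨ ·-comm-* (n ℕ.+ n) u (a * δ) ⟩
    (n ℕ.+ n) · (u * (a * δ))                    ≈⟨ ·-congʳ (n ℕ.+ n) (*-assoc u a δ) ⟨
    (n ℕ.+ n) · (u * a * δ)                      ≈⟨ ·-assoc-* (n ℕ.+ n) (u * a) δ ⟨
    (n ℕ.+ n) · (u * a) * δ                      ∎
    where
    left : (1 · a) * (n · δ) ≈ n · (a * δ)
    left = trans (*-congʳ (·-homo-1 a)) (·-comm-* n a δ)
    right : (n · δ) * (1 · a) ≈ n · (a * δ)
    right = trans (*-congˡ (·-homo-1 a)) (trans (·-assoc-* n δ a) (·-congʳ n (*-comm δ a)))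

  -- For n ≥ 2 the coefficient z n enters (z')² only through 2 · z'(0) · z'(n-1), and V ∘ˢ z only through V 1 * z n.
  residual-top : ∀ k {z w δ} → let n = suc (suc k) in
    InTK U → InTK z → AgreeBelow n z w → z n ≈ w n + δ →
    residual z n ≈ residual w n + slope n (U 1 * w 1) * δ
  residual-top k {z} {w} {δ} U0≈0 z0≈0 z≈w z-top = begin
    lhs z - rhs z                           ≈⟨ +-cong lhs-top (-‿cong rhs-top) ⟩
    (lhs w + A * δ) - (rhs w + V 1 * δ)     ≈⟨ +-congˡ (-‿+-comm _ _) ⟨
    (lhs w + A * δ) + (- rhs w - V 1 * δ)   ≈⟨ interchange _ _ _ _ ⟩
    (lhs w - rhs w) + (A * δ - V 1 * δ)     ≈⟨ +-congˡ ([y-z]x≈yx-zx δ A (V 1)) ⟨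
    (lhs w - rhs w) + (A - V 1) * δ         ∎
    where
    n = suc (suc k)
    A = (n ℕ.+ n) · (U 1 * w 1)
    lhs rhs : PS → Carrier
    lhs z = (U ⊛ (deriv z ⊛ deriv z)) n
    rhs z = (V ∘ˢ z) n
    z'≈w' = deriv-agree z≈w
    z'-top = deriv-perturb {suc k} {z} {w} z-top
    lhs-top : lhs z ≈ lhs w + A * δ
    lhs-top = trans (⊛-perturbʳ (suc k) U0≈0 (⊛-agree z'≈w' z'≈w')
                                (⊛-perturb k z'≈w' z'≈w' z'-top z'-top))
                    (+-congˡ (cross-terms n (U 1) (w 1) δ))
    rhs-top : rhs z ≈ rhs w + V 1 * δ
    rhs-top = ∘ˢ-perturb (suc k) z0≈0 z≈w z-top

  coefficients-agree : InTK U → ∀ {z w} → InTK z → InTK w →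
    (∀ n → residual z n ≈ 0#) → (∀ n → residual w n ≈ 0#) → z 1 ≈ w 1 →
    (∀ k → ¬ slope (suc (suc k)) (U 1 * w 1) ≈ 0#) → ∀ n → AgreeBelow n z w
  coefficients-agree U0≈0 {z} {w} z0≈0 w0≈0 z-residual w-residual z1≈w1 slope≉0 = agree
    where
    step : ∀ n → AgreeBelow n z w → z n ≈ w n
    step zero          _   = trans z0≈0 (sym w0≈0)
    step (suc zero)    _   = z1≈w1
    step (suc (suc k)) z≈w = begin
      z n          ≈⟨ x≈y+[x-y] (z n) (w n) ⟩
      w n + δ      ≈⟨ +-congˡ (x*y≈0⇒y≈0 (slope≉0 k) slope*δ≈0) ⟩
      w n + 0#     ≈⟨ +-identityʳ (w n) ⟩
      w n          ∎
      where
      n = suc (suc k)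
      δ = z n - w n
      slope*δ≈0 : slope n (U 1 * w 1) * δ ≈ 0#
      slope*δ≈0 = begin
        slope n (U 1 * w 1) * δ                     ≈⟨ +-identityˡ _ ⟨
        0# + slope n (U 1 * w 1) * δ                ≈⟨ +-congʳ (w-residual n) ⟨
        residual w n + slope n (U 1 * w 1) * δ      ≈⟨ residual-top k U0≈0 z0≈0 z≈w (x≈y+[x-y] (z n) (w n)) ⟨
        residual z n                                ≈⟨ z-residual n ⟩
        0#                                          ∎
    agree : ∀ n → AgreeBelow n z w
    agree zero    _ ()
    agree (suc n) = agreeBelow-suc (agree n) (step n (agree n))

module Solution {c ℓ : Level} (K : Field c ℓ) (E : AlgebraicExtensionOfℚ₂ K) (U V : PowerSeries.PS K)
                (U-val : PowerSeries.HasValuationOne K U) (V-val : PowerSeries.HasValuationOne K V) where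

  open import Data.Nat as ℕ using (ℕ; zero; suc; _≤_; s≤s; z≤n; _≟_)
  open import Data.Nat.Properties using (≤-refl; ≤-pred; ≤∧≢⇒<; <-irrefl; <⇒≤)
  open import Data.Product using (proj₁; proj₂)
  open import Data.Empty using (⊥-elim)
  open import Relation.Nullary using (¬_; yes; no)
  import Relation.Binary.PropositionalEquality as ≡
  open Field K
  open PowerSeries K
  open FieldProperties K
  open PowerSeriesProperties K
  open Equation K U V
  open import Algebra.Properties.Ring ring using (x∙y⁻¹≈ε⇒x≈y; x≈y⇒x∙y⁻¹≈ε)
  open import Relation.Binary.Reasoning.Setoid setoid

  private
    U0≈0 = proj₁ U-val
    U1≉0 = proj₂ U-val
    V0≈0 = proj₁ V-val
    V1≉0 = proj₂ V-val

  a₁ : Carrier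
  a₁ = V 1 * U 1 ⁻¹⟨ U1≉0 ⟩

  U1*a₁≈V1 : U 1 * a₁ ≈ V 1
  U1*a₁≈V1 = x*[y*x⁻¹]≈y (U 1) (V 1) U1≉0

  a₁≉0 : ¬ a₁ ≈ 0#
  a₁≉0 a₁≈0 = V1≉0 (trans (sym U1*a₁≈V1) (trans (*-congˡ a₁≈0) (zeroʳ (U 1))))

  slope-a₁≉0 : ∀ k → ¬ slope (suc (suc k)) (U 1 * a₁) ≈ 0#
  slope-a₁≉0 k s≈0 =
    slope-V1≉0 (CharacteristicZero.odd·1≉0 K E) V1≉0 (suc k) (trans (sym (slope-cong (suc (suc k)) U1*a₁≈V1)) s≈0)

  -- The coefficient of t^n, computed from a series w holding the coefficients below n.
  next : ℕ → PS → Carrier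
  next zero          w = 0#
  next (suc zero)    w = a₁
  next (suc (suc k)) w = - residual w (suc (suc k)) * slope (suc (suc k)) (U 1 * a₁) ⁻¹⟨ slope-a₁≉0 k ⟩

  approx : ℕ → PS
  approx zero    i = 0#
  approx (suc n) i with i ≟ n
  ... | yes _ = next n (approx n)
  ... | no  _ = approx n i

  solution : PS
  solution n = next n (approx n)

  approx-agree : ∀ n → AgreeBelow n (approx n) solution
  approx-agree (suc n) i i<1+n with i ≟ n
  ... | yes ≡.refl = refl
  ... | no  i≢n    = approx-agree n i (≤∧≢⇒< (≤-pred i<1+n) i≢n)

  approx-above : ∀ n i → n ≤ i → approx n i ≈ 0#
  approx-above zero    i _     = refl
  approx-above (suc n) i n<i with i ≟ n
  ... | yes ≡.refl = ⊥-elim (<-irrefl ≡.refl n<i)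
  ... | no  _      = approx-above n i (<⇒≤ n<i)

  solution-residual : ∀ n → residual solution n ≈ 0#
  solution-residual zero          = residual-0 U0≈0 V0≈0 solution
  solution-residual (suc zero)    = trans (residual-1 U0≈0 solution) (x≈y⇒x∙y⁻¹≈ε (*-congʳ U1*a₁≈V1))
  solution-residual (suc (suc k)) = begin
    residual solution n                        ≈⟨ residual-top k U0≈0 refl z≈w z-top ⟩
    residual w n + slope n (U 1 * w 1) * δ     ≈⟨ +-congˡ (*-congʳ (slope-cong n (*-congˡ w1≈a₁))) ⟩
    residual w n + slope n (U 1 * a₁) * δ      ≈⟨ +-congˡ (x*[y*x⁻¹]≈y _ (- residual w n) (slope-a₁≉0 k)) ⟩
    residual w n - residual w n                ≈⟨ -‿inverseʳ (residual w n) ⟩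
    0#                                         ∎
    where
    n = suc (suc k)
    w = approx n
    δ = solution n
    z≈w : AgreeBelow n solution w
    z≈w i i<n = sym (approx-agree n i i<n)
    z-top : solution n ≈ w n + δ
    z-top = sym (trans (+-congʳ (approx-above n n ≤-refl)) (+-identityˡ δ))
    w1≈a₁ : w 1 ≈ a₁
    w1≈a₁ = approx-agree n 1 (s≤s (s≤s z≤n))

  solution-isNonzeroSolution : IsNonzeroSolution U V solution
  solution-isNonzeroSolution = refl , (λ solution≈0 → a₁≉0 (solution≈0 1)) , residual≈0⇒solves solution-residual

  -- A nonzero solution has w 1 ≉ 0, since otherwise it would agree with 0ˢ; then u₁ w₁² = v₁ w₁ forces w 1 = a₁.
  solution-unique : ∀ w → IsNonzeroSolution U V w → w ≈ˢ solution
  solution-unique w (w0≈0 , w≉0 , w-solves) n = agree-with (suc n) n ≤-refl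
    where
    w-residual = residual≈0 w-solves
    w1≉0 : ¬ w 1 ≈ 0#
    w1≉0 w1≈0 = w≉0 λ i →
      coefficients-agree U0≈0 w0≈0 refl w-residual (residual-0ˢ V0≈0) w1≈0
        (λ k → slope-0≉0 (suc (suc k)) V1≉0 (zeroʳ (U 1))) (suc i) i ≤-refl
    U1*w1≈V1 : U 1 * w 1 ≈ V 1
    U1*w1≈V1 = *-cancelʳ w1≉0 (x∙y⁻¹≈ε⇒x≈y _ _ (trans (sym (residual-1 U0≈0 w)) (w-residual 1)))
    w1≈a₁ : w 1 ≈ a₁
    w1≈a₁ = *-cancelˡ U1≉0 (trans U1*w1≈V1 (sym U1*a₁≈V1))
    agree-with : ∀ n → AgreeBelow n w solution
    agree-with = coefficients-agree U0≈0 w0≈0 refl w-residual solution-residual w1≈a₁ slope-a₁≉0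

proposition2p1 : {c ℓ : Level} (K : Field c ℓ) → AlgebraicExtensionOfℚ₂ K →
    (U V : PowerSeries.PS K) →
    PowerSeries.HasValuationOne K U → PowerSeries.HasValuationOne K V →
    Σ (PowerSeries.PS K) λ z → PowerSeries.IsNonzeroSolution K U V z ×
      ((w : PowerSeries.PS K) → PowerSeries.IsNonzeroSolution K U V w →
        PowerSeries._≈ˢ_ K w z)
proposition2p1 K E U V U-val V-val = solution , solution-isNonzeroSolution , solution-unique
  where open Solution K E U V U-val V-val
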